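{- Let $u_0,u,v,v_0$ be integers with $u_0 \leq u \leq v \leq v_0$, and let $A$ be a set of integers such that $\{u_0,v_0\} \cup [u,v] \subseteq A \subseteq [u_0,v_0]$. Let $r \geq 2$ be an integer. If the integer $\ell$ satisfies \[ \ell \geq \frac{r(v_0-u_0)+1}{v-u+1} \] and \[ X_\ell = \{ r u_0 - u + i(v-u+1) : i = 0,1,\ldots,\ell-1\}, \] then $rA \subseteq X_\ell + A$, and $A$ is an $(r,\ell)$-approximate group.
   Context: For integers $u \le v$, $[u,v]=\{n\in\mathbb{Z} : u\le n\le v\}$. For nonempty subsets $A, X$ of $\mathbb{Z}$, $X+A=\{x+a : x\in X, a\in A\}$ and, for a positive integer $h$, $hA=\{a_1+\cdots+a_h : a_i \in A\}$. For positive integers $r,\ell$, a set $A$ is an $(r,\ell)$-approximate group if $A$ is a nonempty subset of the group ($\mathbb{Z}$ here) and there exists a subset $X$ with $|X| \leq \ell$ and $rA \subseteq X + A$. -}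

module Defs where

open import Level using (0ℓ)
open import Data.Nat using (ℕ; _<_)
open import Data.Integer using (ℤ; +_; _+_; _-_; _*_; _≤_)
open import Data.List using (List; length; foldr)
open import Data.List.Relation.Unary.All using (All)
open import Data.List.Membership.Propositional using (_∈_)
open import Data.Product using (Σ; _×_; ∃)
open import Relation.Binary.PropositionalEquality using (_≡_)
open import Relation.Unary using (Pred; _⊆_)

SetZ : Set₁
SetZ = Pred ℤ 0ℓ

Icc : ℤ → ℤ → SetZ
Icc u v n = (u ≤ n) × (n ≤ v)

sumℤ : List ℤ → ℤ
sumℤ = foldr _+_ (+ 0)

sumset : ℕ → SetZ → SetZ
sumset h A n = Σ (List ℤ) λ as → (length as ≡ h) × All A as × (sumℤ as ≡ n)

_⊕_ : SetZ → SetZ → SetZ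
(X ⊕ A) n = Σ ℤ λ x → Σ ℤ λ a → X x × A a × (n ≡ x + a)

listSet : List ℤ → SetZ
listSet xs n = n ∈ xs

-- A is an (r , ℓ)-approximate group in ℤ: A nonempty and there is a finite
-- X (given by a list, so |X| ≤ length xs) with |X| ≤ ℓ and rA ⊆ X + A.
IsApproxGroup : ℕ → ℕ → SetZ → Set
IsApproxGroup r ℓ A =
  (∃ λ a → A a) ×
  (Σ (List ℤ) λ xs → (length xs Data.Nat.≤ ℓ) × (sumset r A ⊆ (listSet xs ⊕ A)))

Xell : ℕ → ℕ → ℤ → ℤ → ℤ → SetZ
Xell r ℓ u₀ u v n =
  Σ ℕ λ i → (i < ℓ) × (n ≡ ((+ r) * u₀ - u) + (+ i) * (v - u + + 1))

module Submission where

-- Every element of A lies in [u₀, v₀], so every r-fold sum of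
-- elements of A lies in [r u₀, r v₀].  The translates of the block
-- [u, v] ⊆ A by the ℓ shifts x_i = r u₀ - u + i (v - u + 1), i < ℓ, are
-- consecutive disjoint blocks of width v - u + 1 starting at r u₀, so they
-- tile [r u₀, r u₀ + ℓ (v - u + 1) - 1]; by the hypothesis on ℓ this interval
-- contains [r u₀, r v₀].  Hence rA ⊆ X_ℓ + [u, v] ⊆ X_ℓ + A, and listing
-- X_ℓ gives a witness of size ℓ for A being an (r, ℓ)-approximate group.
--
-- The theorem then combines them.

open import Defs
open import Data.Nat using (ℕ; suc)
open import Data.Integer using (ℤ; +_; _+_; _-_; _*_; _≤_; _<_; -_)
open import Data.Product using (Σ; _×_; _,_)
open import Relation.Unary using (_⊆_)

import Data.Nat as ℕ
import Data.Nat.Properties as ℕ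
open import Data.Nat.DivMod using (_/_; _%_; m≡m%n+[m/n]*n; m%n<n; m<n*o⇒m/o<n)
import Data.Integer as ℤ
open import Data.Integer.Properties
  using (≤-refl; ≤-trans; ≤-reflexive; ≤-<-trans; +-mono-≤; +-monoʳ-≤; +-monoʳ-<;
         i≤i+j; i≤j⇒0≤j-i; 0≤i⇒+∣i∣≡i; suc[i]≤j⇒i<j; +-comm; pos-+; pos-*; suc-*;
         drop‿+<+)
open import Data.Integer.Tactic.RingSolver using (solve-∀)
open import Data.List using (List; []; _∷_; length; applyUpTo)
open import Data.List.Properties using (length-applyUpTo)
open import Data.List.Relation.Unary.All using (All; []; _∷_)
import Data.List.Relation.Unary.All as All
open import Data.List.Membership.Propositional.Properties using (∈-applyUpTo⁺)
open import Function using (id; _∘_)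
open import Relation.Binary.PropositionalEquality
  using (_≡_; refl; sym; trans; cong; subst; subst₂; module ≡-Reasoning)

gap : ∀ {x y : ℤ} → x ≤ y → Σ ℕ λ k → y ≡ x + + k
gap {x} {y} x≤y = ℤ.∣ y - x ∣ , (begin
  y                  ≡⟨ y≡x+[y-x] x y ⟩
  x + (y - x)        ≡⟨ cong (λ z → x + z) (sym (0≤i⇒+∣i∣≡i (i≤j⇒0≤j-i x≤y))) ⟩
  x + + ℤ.∣ y - x ∣  ∎)
  where
  open ≡-Reasoning
  y≡x+[y-x] : ∀ x y → y ≡ x + (y - x)
  y≡x+[y-x] = solve-∀

+-cancelˡ-< : ∀ m {a b : ℤ} → m + a < m + b → a < b
+-cancelˡ-< m {a} {b} lt = subst₂ _<_ (cancel m a) (cancel m b) (+-monoʳ-< (- m) lt)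
  where
  cancel : ∀ m x → - m + (m + x) ≡ x
  cancel = solve-∀

sum-bounds : ∀ {a b} (xs : List ℤ) → All (Icc a b) xs →
             Icc (+ length xs * a) (+ length xs * b) (sumℤ xs)
sum-bounds {a} {b} [] [] = ≤-refl , ≤-refl
sum-bounds {a} {b} (x ∷ xs) ((a≤x , x≤b) ∷ rest) with sum-bounds xs rest
... | lo , hi =
  ≤-trans (≤-reflexive (suc-* (+ length xs) a)) (+-mono-≤ a≤x lo) ,
  ≤-trans (+-mono-≤ x≤b hi) (≤-reflexive (sym (suc-* (+ length xs) b)))

sumset-bounds : ∀ {A : SetZ} {a b} h → A ⊆ Icc a b → sumset h A ⊆ Icc (+ h * a) (+ h * b)
sumset-bounds _ A⊆Iab (xs , refl , allA , refl) = sum-bounds xs (All.map A⊆Iab allA)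

⊕-mono : ∀ {X X′ A A′ : SetZ} → X ⊆ X′ → A ⊆ A′ → (X ⊕ A) ⊆ (X′ ⊕ A′)
⊕-mono X⊆X′ A⊆A′ (x , a , Xx , Aa , n≡x+a) = x , a , X⊆X′ Xx , A⊆A′ Aa , n≡x+a

-- The arithmetic progression {c + i s : i < ℓ}; note that X_ℓ is
-- definitionally Progression (r u₀ - u) (v - u + 1) ℓ.
Progression : ℤ → ℤ → ℕ → SetZ
Progression c s ℓ n = Σ ℕ λ i → (i ℕ.< ℓ) × (n ≡ c + (+ i) * s)

progressionList : ℤ → ℤ → ℕ → List ℤ
progressionList c s = applyUpTo (λ i → c + (+ i) * s)
progression⊆list : ∀ c s ℓ → Progression c s ℓ ⊆ listSet (progressionList c s ℓ)
progression⊆list c s ℓ (i , i<ℓ , refl) = ∈-applyUpTo⁺ (λ i → c + (+ i) * s) i<ℓ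

-- Writing n = m + t and
-- t = j + i (v - u + 1) with j ≤ v - u (division with remainder), n is the
-- i-th shift plus the block element u + j.
tiling : ∀ {u v} → u ≤ v → ∀ m ℓ {n} → m ≤ n → n < m + (+ ℓ) * (v - u + + 1) →
         (Progression (m - u) (v - u + + 1) ℓ ⊕ Icc u v) n
tiling {u} u≤v m ℓ m≤n n<end with d , refl ← gap u≤v | t , refl ← gap m≤n =
  (m - u) + + i * width , u + + j , (i , i<ℓ , refl) , (i≤i+j u (+ j) , j-in-block) , decompose
  where
  open ≡-Reasoning
  width : ℤ
  width = (u + + d) - u + + 1
  i j : ℕ
  i = t / suc d
  j = t % suc d

  width≡ : width ≡ + suc d
  width≡ = trans (w u (+ d)) (sym (pos-+ 1 d))
    where
    w : ∀ u d → (u + d) - u + + 1 ≡ + 1 + d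
    w = solve-∀

  t<ℓw : t ℕ.< ℓ ℕ.* suc d
  t<ℓw = drop‿+<+ (+-cancelˡ-< m (subst (λ k → m + + t < m + k) ℓ*width≡ n<end))
    where
    ℓ*width≡ : + ℓ * width ≡ + (ℓ ℕ.* suc d)
    ℓ*width≡ = trans (cong (λ w → + ℓ * w) width≡) (sym (pos-* ℓ (suc d)))

  i<ℓ : i ℕ.< ℓ
  i<ℓ = m<n*o⇒m/o<n t<ℓw

  j-in-block : u + + j ≤ u + + d
  j-in-block = +-monoʳ-≤ u (ℤ.+≤+ (ℕ.≤-pred (m%n<n t (suc d))))

  regroup : ∀ m u i w j → m + (j + i * w) ≡ ((m - u) + i * w) + (u + j)
  regroup = solve-∀

  decompose : m + + t ≡ ((m - u) + + i * width) + (u + + j)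
  decompose = begin
    m + + t                                ≡⟨ cong (λ k → m + + k) (m≡m%n+[m/n]*n t (suc d)) ⟩
    m + + (j ℕ.+ i ℕ.* suc d)              ≡⟨ cong (λ z → m + z) (trans (pos-+ j _) (cong (λ z → + j + z) (pos-* i (suc d)))) ⟩
    m + (+ j + + i * + suc d)              ≡⟨ regroup m u (+ i) (+ suc d) (+ j) ⟩
    ((m - u) + + i * + suc d) + (u + + j)  ≡⟨ cong (λ w → ((m - u) + + i * w) + (u + + j)) (sym width≡) ⟩
    ((m - u) + + i * width) + (u + + j)    ∎

mainTheorem3 : (u₀ u v v₀ : ℤ) → u₀ ≤ u → u ≤ v → v ≤ v₀ →
    (A : SetZ) → A u₀ → A v₀ → Icc u v ⊆ A → A ⊆ Icc u₀ v₀ →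
    (r : ℕ) → 2 Data.Nat.≤ r →
    (ℓ : ℕ) → (+ r) * (v₀ - u₀) + + 1 ≤ (+ ℓ) * (v - u + + 1) →
    (sumset r A ⊆ (Xell r ℓ u₀ u v ⊕ A)) × IsApproxGroup r ℓ A
mainTheorem3 u₀ u v v₀ _ u≤v _ A _ _ block⊆A A⊆range r _ ℓ ℓ-large =
  rA⊆Xℓ+A ,
  (u , block⊆A (≤-refl , u≤v)) ,
  progressionList shift width ℓ ,
  ℕ.≤-reflexive (length-applyUpTo _ ℓ) ,
  ⊕-mono (progression⊆list shift width ℓ) id ∘ rA⊆Xℓ+A
  where
  shift width : ℤ
  shift = (+ r) * u₀ - u
  width = v - u + + 1

  below-tiling-end : ∀ {n} → n ≤ + r * v₀ → n < + r * u₀ + + ℓ * width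
  below-tiling-end {n} n≤rv₀ = ≤-<-trans n≤rv₀ (subst₂ _<_ (sym (expand (+ r) u₀ v₀)) refl
    (+-monoʳ-< (+ r * u₀) (suc[i]≤j⇒i<j (≤-trans (≤-reflexive (+-comm (+ 1) (+ r * (v₀ - u₀)))) ℓ-large))))
    where
    expand : ∀ r u₀ v₀ → r * v₀ ≡ r * u₀ + r * (v₀ - u₀)
    expand = solve-∀

  rA⊆Xℓ+A : sumset r A ⊆ (Xell r ℓ u₀ u v ⊕ A)
  rA⊆Xℓ+A rA-n with lo , hi ← sumset-bounds r A⊆range rA-n =
    ⊕-mono id block⊆A (tiling u≤v (+ r * u₀) ℓ lo (below-tiling-end hi))
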